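{- Let $k\geq3$ be odd and $n\geq 3$. Suppose $X$ is a set of edges of $B_k(n-1)$ that is Eulerian and antinegasymmetric and contains $E_k(n-1)$. Then $X\setminus E_k(n-1)$ consists only of edges of complete circuits from $\mathcal{C}_k(n-1)$ (i.e. it is a union of edge sets of circuits in $\mathcal{C}_k(n-1)$), and none of these circuits is negasymmetric.
   Context: Tuples are $k$-ary (entries in $\mathbb{Z}_k$), negation is modulo $k$, $\mathbf{u}^R$ is the reverse of $\mathbf{u}$. The pseudoweight of $a\in\mathbb{Z}_k$ is $a$ if $a\ne0$ and $k/2$ if $a=0$, and of a tuple the sum over its entries. $B_k(n-1)$ is the de Bruijn digraph with vertices the $k$-ary $(n-1)$-tuples and edges the $k$-ary $n$-tuples $(a_0,\dots,a_{n-1})$ from $(a_0,\dots,a_{n-2})$ to $(a_1,\dots,a_{n-1})$. $E_k(n-1)$ is the set of edges of pseudoweight less than $kn/2$; $H_k(n-1)$ is the subgraph of edges of pseudoweight exactly $kn/2$. For an $n$-tuple $(a_0,\dots,a_{n-1})$, with $p$ the least positive $c$ such that $a_i=a_{(i+c)\bmod n}$ for all $i$, $[a_0,\dots,a_{n-1}]$ is the circuit whose edges are the $p$ cyclic shifts $(a_j,\dots,a_{j+n-1})$ (indices mod $n$), $0\le j<p$. $\mathcal{C}_k(n-1)$ is the set of such circuits arising from edges of $H_k(n-1)$. A circuit is negasymmetric if it contains edges $\mathbf a,\mathbf b$ (not necessarily distinct) with $\mathbf a=-\mathbf b^R$. A set of edges is Eulerian if the subgraph formed by these edges and their incident vertices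 is connected and each of its vertices has in-degree equal to out-degree; it is antinegasymmetric if $\mathbf a\ne-\mathbf b^R$ for all edges $\mathbf a,\mathbf b$ in it (including $\mathbf a=\mathbf b$). -}

module Defs where

open import Data.Nat using (ℕ; zero; suc; _+_; _*_; _<_; _≤_)
open import Data.Nat.DivMod using (_mod_)
open import Data.Fin using (Fin; zero; suc; toℕ; opposite; inject₁)
open import Data.Vec using (Vec; []; _∷_; _∷ʳ_; map; reverse; init; tail; lookup; sum)
open import Data.List using (List) renaming (map to mapL)
open import Data.Nat.ListAction using () renaming (sum to sumL)
open import Data.Bool using (Bool; true; false; if_then_else_)
open import Data.Product using (Σ; ∃; _×_; _,_)
open import Relation.Binary.PropositionalEquality using (_≡_)
open import Relation.Nullary using (¬_)
open import Data.List using (allFin)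

-- k-ary tuples of length n; here n = suc m, so edges of B_k(n-1) are
-- tuples of length suc m and vertices tuples of length m.
Edge : ℕ → ℕ → Set
Edge k m = Vec (Fin k) (suc m)

Vertex : ℕ → ℕ → Set
Vertex k m = Vec (Fin k) m

src : ∀ {k m} → Edge k m → Vertex k m
src = init

tgt : ∀ {k m} → Edge k m → Vertex k m
tgt = tail

-- negation modulo k
negF : ∀ {k} → Fin k → Fin k
negF {suc j} zero = zero
negF {suc j} (suc i) = opposite (inject₁ i)

negT : ∀ {k n} → Vec (Fin k) n → Vec (Fin k) n
negT = map negF

-- TWICE the pseudoweight (k may be odd, so k/2 is not a natural number)
pw2 : ∀ {k} → Fin k → ℕ
pw2 {k} zero = k
pw2 (suc i) = 2 * suc (toℕ i)

pw2T : ∀ {k n} → Vec (Fin k) n → ℕ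
pw2T v = sum (map pw2 v)

InE : ∀ {k m} → Edge k m → Set
InE {k} {m} e = pw2T e < k * suc m

InH : ∀ {k m} → Edge k m → Set
InH {k} {m} e = pw2T e ≡ k * suc m

EdgeSet : ℕ → ℕ → Set
EdgeSet k m = Edge k m → Bool

_∈E_ : ∀ {k m} → Edge k m → EdgeSet k m → Set
e ∈E X = X e ≡ true

indeg : ∀ {k m} → EdgeSet k m → Vertex k m → ℕ
indeg {k} X v = sumL (mapL (λ a → if X (a ∷ v) then 1 else 0) (allFin k))

outdeg : ∀ {k m} → EdgeSet k m → Vertex k m → ℕ
outdeg {k} X v = sumL (mapL (λ a → if X (v ∷ʳ a) then 1 else 0) (allFin k))

data Conn {k m} (X : EdgeSet k m) (u : Vertex k m) : Vertex k m → Set where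
  here : Conn X u u
  fwd  : ∀ {e} → Conn X u (src e) → e ∈E X → Conn X u (tgt e)
  bwd  : ∀ {e} → Conn X u (tgt e) → e ∈E X → Conn X u (src e)

-- the subgraph formed by the edges of X and their incident vertices is
-- connected (every incident vertex is linked to src e by e itself)
Connected : ∀ {k m} → EdgeSet k m → Set
Connected X = ∀ e f → e ∈E X → f ∈E X → Conn X (src e) (src f)

-- Eulerian: connected, and in-degree = out-degree at every vertex
-- (vertices not incident to X have both degrees 0)
Eulerian : ∀ {k m} → EdgeSet k m → Set
Eulerian X = Connected X × (∀ v → indeg X v ≡ outdeg X v)

Antinegasymmetric : ∀ {k m} → EdgeSet k m → Set
Antinegasymmetric X = ∀ a b → a ∈E X → b ∈E X → ¬ (a ≡ negT (reverse b))

rot1 : ∀ {A : Set} {m} → Vec A (suc m) → Vec A (suc m)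
rot1 (x ∷ xs) = xs ∷ʳ x

shift : ∀ {A : Set} {m} → ℕ → Vec A (suc m) → Vec A (suc m)
shift zero a = a
shift (suc j) a = shift j (rot1 a)

IsPeriod : ∀ {k m} → Edge k m → ℕ → Set
IsPeriod {k} {m} a c = ∀ (i : Fin (suc m)) → lookup a i ≡ lookup a ((toℕ i + c) mod suc m)

IsLeastPeriod : ∀ {k m} → Edge k m → ℕ → Set
IsLeastPeriod a p = 0 < p × IsPeriod a p × (∀ c → 0 < c → c < p → ¬ IsPeriod a c)

InCircuit : ∀ {k m} → Edge k m → Edge k m → Set
InCircuit a f = Σ ℕ λ p → IsLeastPeriod a p × Σ ℕ λ j → j < p × f ≡ shift j a

Negasymmetric : ∀ {k m} → Edge k m → Set
Negasymmetric a = Σ _ λ f → Σ _ λ g → InCircuit a f × InCircuit a g × f ≡ negT (reverse g)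

Odd : ℕ → Set
Odd k = Σ ℕ λ j → k ≡ suc (2 * j)

{-# OPTIONS --safe #-}
-- Since pw(f) + pw(−fᴿ) = kn, an edge f of pseudoweight above kn/2 cannot lie in X: −fᴿ is in
-- E ⊆ X and X is antinegasymmetric. So X ∖ E ⊆ H. If a₀w ∈ X ∩ H then, for every symbol a ≠ a₀,
-- the edges aw and wa have the same pseudoweight, which is not kn/2 because for odd k the
-- pseudoweight of a symbol determines it; so X contains both or neither, and the balance of
-- in- and out-degree at w forces wa₀ ∈ X. Thus X ∩ H is closed under cyclic shifts and contains
-- the circuit of each of its edges, which then cannot be negasymmetric.
module Submission where

open import Defs
open import Data.Bool using (Bool; true; false; if_then_else_)
open import Data.Empty using (⊥-elim)
open import Data.Fin using (Fin; zero; suc; toℕ; opposite; inject₁)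
open import Data.Fin.Properties
  using (toℕ-injective; toℕ-fromℕ<; opposite-prop; toℕ-inject₁; toℕ<n; all?)
  renaming (_≟_ to _≟ᶠ_)
open import Data.List using (List; []; _∷_; allFin) renaming (map to mapL)
open import Data.List.Membership.Propositional using (_∈_)
open import Data.List.Membership.Propositional.Properties using (∈-allFin)
open import Data.List.Relation.Unary.Any using (here; there)
open import Data.Nat using (ℕ; zero; suc; _≤_; _<_; _+_; _*_; _∸_; z≤n; z<s; _<?_)
open import Data.Nat.DivMod using (_mod_; _%_; [m+n]%n≡m%n; m<n⇒m%n≡m; m%n<n)
open import Data.Nat.ListAction using () renaming (sum to sumL)
open import Data.Nat.Properties
open import Algebra.Properties.CommutativeSemigroup +-commutativeSemigroup
  using (interchange; x∙yz≈y∙xz)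
open import Data.Product using (Σ; ∃; _×_; _,_; proj₁)
open import Data.Vec using (Vec; []; _∷_; _∷ʳ_; map; reverse; lookup; sum)
open import Data.Vec.Properties using (map-∘; reverse-∷)
open import Function using (_∘_)
open import Relation.Binary.Definitions using (DecidableEquality; tri<; tri≈; tri>)
open import Relation.Binary.PropositionalEquality
open import Relation.Nullary using (¬_; yes; no; contradiction)
open import Relation.Nullary.Decidable using (_×-dec_)
open import Relation.Unary using (Decidable)

sum-map-∷ʳ : ∀ {A : Set} {n} (f : A → ℕ) (xs : Vec A n) x →
  sum (map f (xs ∷ʳ x)) ≡ f x + sum (map f xs)
sum-map-∷ʳ f []       x = refl
sum-map-∷ʳ f (y ∷ xs) x = trans (cong (f y +_) (sum-map-∷ʳ f xs x)) (x∙yz≈y∙xz (f y) (f x) _)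

sum-map-reverse : ∀ {A : Set} {n} (f : A → ℕ) (xs : Vec A n) →
  sum (map f (reverse xs)) ≡ sum (map f xs)
sum-map-reverse f []       = refl
sum-map-reverse f (x ∷ xs) = begin
  sum (map f (reverse (x ∷ xs))) ≡⟨ cong (sum ∘ map f) (reverse-∷ x xs) ⟩
  sum (map f (reverse xs ∷ʳ x))  ≡⟨ sum-map-∷ʳ f (reverse xs) x ⟩
  f x + sum (map f (reverse xs)) ≡⟨ cong (f x +_) (sum-map-reverse f xs) ⟩
  f x + sum (map f xs)           ∎
  where open ≡-Reasoning

sum-map-complement : ∀ {A : Set} {n c} (f g : A → ℕ) → (∀ x → f x + g x ≡ c) →
  (xs : Vec A n) → sum (map f xs) + sum (map g xs) ≡ n * c
sum-map-complement f g f+g≡c []       = refl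
sum-map-complement f g f+g≡c (x ∷ xs) =
  trans (interchange (f x) _ (g x) _) (cong₂ _+_ (f+g≡c x) (sum-map-complement f g f+g≡c xs))

sum-map-mono-≤ : ∀ {A : Set} {f g : A → ℕ} → (∀ x → f x ≤ g x) →
  (xs : List A) → sumL (mapL f xs) ≤ sumL (mapL g xs)
sum-map-mono-≤ f≤g []       = z≤n
sum-map-mono-≤ f≤g (x ∷ xs) = +-mono-≤ (f≤g x) (sum-map-mono-≤ f≤g xs)

sum-map-mono-< : ∀ {A : Set} {f g : A → ℕ} {x₀ xs} → (∀ x → f x ≤ g x) →
  x₀ ∈ xs → f x₀ < g x₀ → sumL (mapL f xs) < sumL (mapL g xs)
sum-map-mono-< {xs = _ ∷ xs} f≤g (here refl) lt = +-mono-<-≤ lt (sum-map-mono-≤ f≤g xs)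
sum-map-mono-< {xs = x ∷ _}  f≤g (there x₀∈) lt = +-mono-≤-< (f≤g x) (sum-map-mono-< f≤g x₀∈ lt)

count : ∀ {A : Set} → (A → Bool) → List A → ℕ
count p xs = sumL (mapL (λ x → if p x then 1 else 0) xs)

count-< : ∀ {A : Set} → DecidableEquality A → ∀ {p q : A → Bool} {x₀ xs} →
  (∀ x → x ≢ x₀ → p x ≡ q x) → x₀ ∈ xs → p x₀ ≡ false → q x₀ ≡ true → count p xs < count q xs
count-< _≟_ {p} {q} {x₀} p≡q x₀∈ px₀ qx₀ =
  sum-map-mono-< pointwise x₀∈ strict
  where
  strict : (if p x₀ then 1 else 0) < (if q x₀ then 1 else 0)
  strict rewrite px₀ | qx₀ = z<s
  pointwise : ∀ x → (if p x then 1 else 0) ≤ (if q x then 1 else 0)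
  pointwise x with x ≟ x₀
  ... | yes refl rewrite px₀ = z≤n
  ... | no x≢x₀  rewrite p≡q x x≢x₀ = ≤-refl

count-agree : ∀ {A : Set} → DecidableEquality A → ∀ {p q : A → Bool} {x₀ xs} →
  (∀ x → x ≢ x₀ → p x ≡ q x) → x₀ ∈ xs → count p xs ≡ count q xs → p x₀ ≡ q x₀
count-agree _≟_ {p} {q} {x₀} p≡q x₀∈ eq with p x₀ in px₀ | q x₀ in qx₀
... | false | false = refl
... | true  | true  = refl
... | false | true  = ⊥-elim (<-irrefl eq (count-< _≟_ p≡q x₀∈ px₀ qx₀))
... | true  | false = ⊥-elim (<-irrefl (sym eq) (count-< _≟_ (λ x x≢x₀ → sym (p≡q x x≢x₀)) x₀∈ qx₀ px₀))

toℕ-negF-suc : ∀ {j} (i : Fin j) → toℕ (negF (suc i)) + toℕ (suc i) ≡ suc j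
toℕ-negF-suc {j} i = begin
  toℕ (opposite (inject₁ i)) + suc (toℕ i) ≡⟨ cong (_+ suc (toℕ i)) (opposite-prop (inject₁ i)) ⟩
  j ∸ toℕ (inject₁ i) + suc (toℕ i)         ≡⟨ cong (λ t → j ∸ t + suc (toℕ i)) (toℕ-inject₁ i) ⟩
  j ∸ toℕ i + suc (toℕ i)                   ≡⟨ +-suc (j ∸ toℕ i) (toℕ i) ⟩
  suc (j ∸ toℕ i + toℕ i)                   ≡⟨ cong suc (m∸n+n≡m (<⇒≤ (toℕ<n i))) ⟩
  suc j                                     ∎
  where open ≡-Reasoning

pw2-negF : ∀ {k} (a : Fin k) → pw2 (negF a) + pw2 a ≡ 2 * k
pw2-negF {k} zero = cong (k +_) (sym (+-identityʳ k))
pw2-negF {suc j} (suc i) with negF (suc i) | toℕ-negF-suc i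
... | zero  | i+1≡j+1 = ⊥-elim (<-irrefl (suc-injective i+1≡j+1) (toℕ<n i))
... | suc y | sum≡j+1 = begin
  2 * toℕ (suc y) + 2 * toℕ (suc i) ≡⟨ *-distribˡ-+ 2 (toℕ (suc y)) (toℕ (suc i)) ⟨
  2 * (toℕ (suc y) + toℕ (suc i))   ≡⟨ cong (2 *_) sum≡j+1 ⟩
  2 * suc j                         ∎
  where open ≡-Reasoning

pw2-injective : ∀ {k} → Odd k → (a b : Fin k) → pw2 a ≡ pw2 b → a ≡ b
pw2-injective _          zero    zero    _  = refl
pw2-injective (j , refl) zero    (suc b) eq = ⊥-elim (even≢odd (suc (toℕ b)) j (sym eq))
pw2-injective (j , refl) (suc a) zero    eq = ⊥-elim (even≢odd (suc (toℕ a)) j eq)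
pw2-injective _          (suc a) (suc b) eq =
  cong suc (toℕ-injective (suc-injective (*-cancelˡ-≡ (suc (toℕ a)) (suc (toℕ b)) 2 eq)))

pw2T-rot1 : ∀ {k m} (e : Edge k m) → pw2T (rot1 e) ≡ pw2T e
pw2T-rot1 (a ∷ w) = sum-map-∷ʳ pw2 w a

pw2T-shift : ∀ {k m} j (e : Edge k m) → pw2T (shift j e) ≡ pw2T e
pw2T-shift zero    e = refl
pw2T-shift (suc j) e = trans (pw2T-shift j (rot1 e)) (pw2T-rot1 e)

pw2T-negT-reverse : ∀ {k n} (v : Vec (Fin k) n) → pw2T (negT (reverse v)) + pw2T v ≡ 2 * (k * n)
pw2T-negT-reverse {k} {n} v = begin
  sum (map pw2 (map negF (reverse v))) + pw2T v ≡⟨ cong (_+ pw2T v) (cong sum (map-∘ pw2 negF (reverse v))) ⟨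
  sum (map (pw2 ∘ negF) (reverse v)) + pw2T v   ≡⟨ cong (_+ pw2T v) (sum-map-reverse (pw2 ∘ negF) v) ⟩
  sum (map (pw2 ∘ negF) v) + pw2T v             ≡⟨ sum-map-complement (pw2 ∘ negF) pw2 pw2-negF v ⟩
  n * (2 * k)                                   ≡⟨ *-comm n (2 * k) ⟩
  2 * k * n                                     ≡⟨ *-assoc 2 k n ⟩
  2 * (k * n)                                   ∎
  where open ≡-Reasoning

m+n≡2*o∧o<n⇒m<o : ∀ {m n o} → m + n ≡ 2 * o → o < n → m < o
m+n≡2*o∧o<n⇒m<o {m} {n} {o} m+n≡2o o<n = +-cancelʳ-< o m o (begin-strict
  m + o <⟨ +-monoʳ-< m o<n ⟩
  m + n ≡⟨ m+n≡2o ⟩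
  2 * o ≡⟨ cong (o +_) (+-identityʳ o) ⟩
  o + o ∎)
  where open ≤-Reasoning

least-witness : ∀ {P : ℕ → Set} → Decidable P → ∀ n → (∃ λ c → c < n × P c) →
  ∃ λ p → P p × (∀ c → c < p → ¬ P c)
least-witness P? (suc n) (c , c<1+n , Pc) with anyUpTo? P? n
... | yes below = least-witness P? n below
... | no none   = n , subst _ c≡n Pc , λ c′ c′<n Pc′ → none (c′ , c′<n , Pc′)
  where
  c≡n : c ≡ n
  c≡n = ≤-antisym (≤-pred c<1+n) (≮⇒≥ λ c<n → none (c , c<n , Pc))

isPeriod? : ∀ {k m} (e : Edge k m) → Decidable (IsPeriod e)
isPeriod? {m = m} e c = all? λ i → lookup e i ≟ᶠ lookup e ((toℕ i + c) mod suc m)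

isPeriod-length : ∀ {k m} (e : Edge k m) → IsPeriod e (suc m)
isPeriod-length {m = m} e i = cong (lookup e) (sym (toℕ-injective (begin
  toℕ ((toℕ i + suc m) mod suc m) ≡⟨ toℕ-fromℕ< (m%n<n (toℕ i + suc m) (suc m)) ⟩
  (toℕ i + suc m) % suc m         ≡⟨ [m+n]%n≡m%n (toℕ i) (suc m) ⟩
  toℕ i % suc m                   ≡⟨ m<n⇒m%n≡m (toℕ<n i) ⟩
  toℕ i                           ∎)))
  where open ≡-Reasoning

leastPeriod : ∀ {k m} (e : Edge k m) → ∃ (IsLeastPeriod e)
leastPeriod {m = m} e
  with least-witness (λ c → (0 <? c) ×-dec isPeriod? e c) (suc (suc m))
                     (suc m , ≤-refl , z<s , isPeriod-length e)
... | p , (0<p , period) , below = p , 0<p , period , λ c 0<c c<p → below c c<p ∘ (0<c ,_)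

inCircuit-self : ∀ {k m} (e : Edge k m) → InCircuit e e
inCircuit-self e with leastPeriod e
... | p , least@(0<p , _) = p , least , 0 , 0<p , refl

module _ {k m} {X : EdgeSet k m} (anti : Antinegasymmetric X) (E⊆X : ∀ e → InE e → e ∈E X) where

  heavy∉X : ∀ {f} → k * suc m < pw2T f → X f ≡ false
  heavy∉X {f} kn<f with X f in f∈X
  ... | false = refl
  ... | true  = ⊥-elim (anti (negT (reverse f)) f (E⊆X _ light) f∈X refl)
    where
    light : InE (negT (reverse f))
    light = m+n≡2*o∧o<n⇒m<o (pw2T-negT-reverse f) kn<f

  X∖E⊆H : ∀ {f} → f ∈E X → ¬ InE f → InH f
  X∖E⊆H {f} f∈X f∉E with <-cmp (pw2T f) (k * suc m)
  ... | tri< light _ _ = ⊥-elim (f∉E light)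
  ... | tri≈ _ h _     = h
  ... | tri> _ _ heavy = contradiction (trans (sym (heavy∉X heavy)) f∈X) λ ()

  X-agree-off-H : ∀ {f g} → pw2T f ≡ pw2T g → ¬ InH f → X f ≡ X g
  X-agree-off-H {f} {g} f≈g f∉H with <-cmp (pw2T f) (k * suc m)
  ... | tri< light _ _ = trans (E⊆X f light) (sym (E⊆X g (subst (_< _) f≈g light)))
  ... | tri≈ _ h _     = ⊥-elim (f∉H h)
  ... | tri> _ _ heavy = trans (heavy∉X heavy) (sym (heavy∉X (subst (_ <_) f≈g heavy)))

  module _ (odd : Odd k) (balanced : ∀ v → indeg X v ≡ outdeg X v) where

    rot1-∈X : ∀ {e} → e ∈E X → InH e → rot1 e ∈E X
    rot1-∈X {a₀ ∷ w} e∈X e∈H =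
      trans (sym (count-agree _≟ᶠ_ in≡out (∈-allFin a₀) (balanced w))) e∈X
      where
      in≡out : ∀ a → a ≢ a₀ → X (a ∷ w) ≡ X (w ∷ʳ a)
      in≡out a a≢a₀ = X-agree-off-H (sym (pw2T-rot1 (a ∷ w))) λ aw∈H →
        a≢a₀ (pw2-injective odd a a₀ (+-cancelʳ-≡ (pw2T w) (pw2 a) (pw2 a₀) (trans aw∈H (sym e∈H))))

    shift-∈X : ∀ j {e} → e ∈E X → InH e → shift j e ∈E X
    shift-∈X zero    e∈X e∈H = e∈X
    shift-∈X (suc j) {e} e∈X e∈H = shift-∈X j (rot1-∈X e∈X e∈H) (trans (pw2T-rot1 e) e∈H)

lemma2p16 : (k m : ℕ) → 3 ≤ k → Odd k → 3 ≤ suc m →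
    (X : EdgeSet k m) → Eulerian X → Antinegasymmetric X →
    (∀ e → InE e → e ∈E X) →
    ∀ e → e ∈E X → ¬ InE e →
      Σ (Edge k m) λ a → InH a × InCircuit a e ×
        (∀ f → InCircuit a f → f ∈E X × ¬ InE f) × ¬ Negasymmetric a
lemma2p16 k m _ odd _ X (_ , balanced) anti E⊆X e e∈X e∉E =
  e , e∈H , inCircuit-self e , circuit⊆X∖E , not-negasymmetric
  where
  e∈H : InH e
  e∈H = X∖E⊆H anti E⊆X e∈X e∉E

  circuit⊆X∖E : ∀ f → InCircuit e f → f ∈E X × ¬ InE f
  circuit⊆X∖E f (_ , _ , j , _ , refl) =
    shift-∈X anti E⊆X odd balanced j e∈X e∈H , <-irrefl (trans (pw2T-shift j e) e∈H)

  not-negasymmetric : ¬ Negasymmetric e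
  not-negasymmetric (f , g , f∈[e] , g∈[e] , f≡-gᴿ) =
    anti f g (proj₁ (circuit⊆X∖E f f∈[e])) (proj₁ (circuit⊆X∖E g g∈[e])) f≡-gᴿ
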